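{- Let $v$ be a partially filled Hex board with $N\ge 1$ empty hexes, and let $H$ be one of the empty hexes. Consider a uniformly random filling of all $N$ empty hexes (each of the $2^N$ fillings equally likely). Let $L_H$ denote the probability that, in this random filling, $H$ is filled with the losing color. Then the probability that $H$ is not critical in the random filling is exactly $2L_H$.
   Context: Hex is played on a rhombic board of hexagonal cells by Alice (amber) and Bob (blue). Alice wins a completely filled board if there is a chain of adjacent amber hexes joining the northwest and southeast sides of the board; Bob wins if there is a chain of adjacent blue hexes joining the northeast and southwest sides. Every completely filled board has exactly one winner. A filling of a partially filled board assigns amber or blue to each empty hex. In a completely filled board, the "losing color" is the color of the player who does not win, and a hex is "critical" if changing the color of that hex changes the winner of the game. For a partially filled board, the probability that an empty hex is critical (resp. not critical, resp. of the losing color) means the fraction of the $2^N$ fillings of the empty hexes in which it is critical (resp. not critical, resp. of the losing color). -}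

module Defs where

open import Data.Nat using (ℕ; zero; suc; _+_; _*_)
open import Data.Fin as Fin using (Fin; toℕ; combine)
open import Data.Fin.Properties using () renaming (_≟_ to _≟ᶠ_)
open import Data.Product using (Σ; _×_; _,_)
open import Data.Product.Properties using (≡-dec)
open import Data.Bool using (Bool; true; false; if_then_else_; _∧_)
open import Data.Maybe using (Maybe; just; nothing)
open import Data.List using (List; []; allFin; cartesianProduct)
  renaming (_∷_ to _∷ˡ_)
open import Data.Vec.Functional using (_∷_)
open import Relation.Nullary using (Dec; yes; no; does)
open import Relation.Binary.PropositionalEquality using (_≡_)

-- Colours: amber (Alice) and blue (Bob).
data Color : Set where
  amber blue : Color

_==ᶜ_ : Color → Color → Bool
amber ==ᶜ amber = true
blue  ==ᶜ blue  = true
_     ==ᶜ _     = false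

other : Color → Color
other amber = blue
other blue  = amber

-- Rows run from the northwest side (r = 0) to the southeast side (r = n-1);
-- columns run from the southwest side (c = 0) to the northeast side (c = n-1).
Cell : ℕ → Set
Cell n = Fin n × Fin n

_≟ᶜᵉˡˡ_ : ∀ {n} (p q : Cell n) → Dec (p ≡ q)
_≟ᶜᵉˡˡ_ = ≡-dec _≟ᶠ_ _≟ᶠ_

Board : ℕ → Set
Board n = Cell n → Color

PartialBoard : ℕ → Set
PartialBoard n = Cell n → Maybe Color

-- Hex adjacency on the rhombus (axial coordinates): the six neighbours of
-- (r , c) are (r , c±1), (r±1 , c), (r+1 , c-1), (r-1 , c+1).
data Adjacent {n : ℕ} : Cell n → Cell n → Set where
  east  : ∀ {r c r' c'} → toℕ r ≡ toℕ r' → suc (toℕ c) ≡ toℕ c' → Adjacent (r , c) (r' , c')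
  west  : ∀ {r c r' c'} → toℕ r ≡ toℕ r' → toℕ c ≡ suc (toℕ c') → Adjacent (r , c) (r' , c')
  south : ∀ {r c r' c'} → suc (toℕ r) ≡ toℕ r' → toℕ c ≡ toℕ c' → Adjacent (r , c) (r' , c')
  north : ∀ {r c r' c'} → toℕ r ≡ suc (toℕ r') → toℕ c ≡ toℕ c' → Adjacent (r , c) (r' , c')
  swd   : ∀ {r c r' c'} → suc (toℕ r) ≡ toℕ r' → toℕ c ≡ suc (toℕ c') → Adjacent (r , c) (r' , c')
  ned   : ∀ {r c r' c'} → toℕ r ≡ suc (toℕ r') → suc (toℕ c) ≡ toℕ c' → Adjacent (r , c) (r' , c')

OnNW : ∀ {n} → Cell n → Set
OnNW (r , c) = toℕ r ≡ 0

OnSE : ∀ {n} → Cell n → Set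
OnSE {n} (r , c) = suc (toℕ r) ≡ n

data AmberReach {n : ℕ} (b : Board n) : Cell n → Set where
  start : ∀ {p} → OnNW p → b p ≡ amber → AmberReach b p
  step  : ∀ {p q} → AmberReach b p → Adjacent p q → b q ≡ amber → AmberReach b q

AliceWins : ∀ {n} → Board n → Set
AliceWins {n} b = Σ (Cell n) λ q → OnSE q × AmberReach b q

-- Given any decision procedure for AliceWins (such procedures exist since the
-- board is finite; the values below do not depend on which one is used).
-- Since every filled board has exactly one winner, Bob wins iff Alice does not.
module _ {n : ℕ} (dec : (b : Board n) → Dec (AliceWins b)) where

  winner : Board n → Color
  winner b = if does (dec b) then amber else blue

  losingColor : Board n → Color
  losingColor b = other (winner b)

  flipAt : Board n → Cell n → Board n
  flipAt b H p = if does (p ≟ᶜᵉˡˡ H) then other (b H) else b p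

  isCriticalᵇ : Board n → Cell n → Bool
  isCriticalᵇ b H = if winner b ==ᶜ winner (flipAt b H) then false else true

  isNotCriticalᵇ : Board n → Cell n → Bool
  isNotCriticalᵇ b H = winner b ==ᶜ winner (flipAt b H)

  hasLosingColorᵇ : Board n → Cell n → Bool
  hasLosingColorᵇ b H = b H ==ᶜ losingColor b

allᵇ : {A : Set} → (A → Bool) → List A → Bool
allᵇ P []        = true
allᵇ P (x ∷ˡ xs) = P x ∧ allᵇ P xs

agreesAt : ∀ {n} → PartialBoard n → Board n → Cell n → Bool
agreesAt v b p with v p
... | nothing = true
... | just x  = b p ==ᶜ x

isFillingᵇ : ∀ {n} → PartialBoard n → Board n → Bool
isFillingᵇ {n} v b = allᵇ (agreesAt v b) (cartesianProduct (allFin n) (allFin n))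

countColorings : (k : ℕ) → ((Fin k → Color) → Bool) → ℕ
countColorings zero    P = if P (λ ()) then 1 else 0
countColorings (suc k) P =
  countColorings k (λ g → P (amber ∷ g)) + countColorings k (λ g → P (blue ∷ g))

toBoard : ∀ {n} → (Fin (n * n) → Color) → Board n
toBoard g (r , c) = g (combine r c)

countFillings : ∀ {n} → PartialBoard n → (Board n → Bool) → ℕ
countFillings {n} v P =
  countColorings (n * n) (λ g → isFillingᵇ v (toBoard g) ∧ P (toBoard g))

{-# OPTIONS --safe #-}
module Submission where

-- Pair each filling b with H amber with the filling b' that differs from it
-- only by H being blue; flipping H in b gives b' and vice versa.  Recolouring a
-- hex amber can only help Alice, so the winners (w, w') of (b, b') are
-- (amber, amber), (blue, blue) or (amber, blue).  In the first two cases H is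
-- non-critical in both boards and has the losing colour in exactly one of them;
-- in the last case H is critical in both and has the winning colour in both.
-- Either way the pair contributes twice as many non-critical events as
-- losing-colour events.

open import Defs
open import Data.Nat using (ℕ; zero; suc; _+_; _*_)
open import Data.Nat.Properties using (*-distribˡ-+; *-zeroʳ; +-commutativeSemigroup)
open import Algebra.Properties.CommutativeSemigroup +-commutativeSemigroup using (interchange)
open import Data.Fin using (Fin; combine; remQuot) renaming (zero to fzero; suc to fsuc)
open import Data.Fin.Properties using (remQuot-combine)
open import Data.Product using (_,_)
open import Data.Bool using (Bool; true; false; if_then_else_; _∧_)
open import Data.Maybe using (just; nothing)
open import Data.List using ([]; _∷_; allFin; cartesianProduct)
open import Data.Vec.Functional using () renaming (_∷_ to _∷ᵛ_)
open import Relation.Nullary using (Dec; yes; no; contradiction)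
open import Relation.Nullary.Decidable using (does-⇔)
open import Function.Bundles using (mk⇔)
open import Relation.Binary.PropositionalEquality

𝟙 : Bool → ℕ
𝟙 b = if b then 1 else 0

record FlipPair {A : Set} (H : A) (b b' : A → Color) : Set where
  field
    amberAt        : b H ≡ amber
    blueAt         : b' H ≡ blue
    agreeElsewhere : ∀ p → p ≢ H → b p ≡ b' p

open FlipPair

FlipPair-head : ∀ {k} (g : Fin k → Color) → FlipPair fzero (amber ∷ᵛ g) (blue ∷ᵛ g)
FlipPair-head g = record
  { amberAt = refl ; blueAt = refl
  ; agreeElsewhere = λ { fzero z≢z → contradiction refl z≢z ; (fsuc j) _ → refl } }

FlipPair-tail : ∀ {k} {i : Fin k} {g g' : Fin k → Color} (c : Color) →
                FlipPair i g g' → FlipPair (fsuc i) (c ∷ᵛ g) (c ∷ᵛ g')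
FlipPair-tail c fp = record
  { amberAt = amberAt fp ; blueAt = blueAt fp
  ; agreeElsewhere = λ { fzero _ → refl
                       ; (fsuc j) j≢i → agreeElsewhere fp j (λ j≡i → j≢i (cong fsuc j≡i)) } }

countColorings-pointwise : ∀ k m (A B P Q : (Fin k → Color) → Bool) →
  (∀ g → 𝟙 (A g) + 𝟙 (B g) ≡ m * (𝟙 (P g) + 𝟙 (Q g))) →
  countColorings k A + countColorings k B ≡ m * (countColorings k P + countColorings k Q)
countColorings-pointwise zero    m A B P Q eq = eq (λ ())
countColorings-pointwise (suc k) m A B P Q eq = begin
  (#A amber + #A blue) + (#B amber + #B blue)  ≡⟨ interchange (#A amber) (#A blue) (#B amber) (#B blue) ⟩
  (#A amber + #B amber) + (#A blue + #B blue)  ≡⟨ cong₂ _+_ (on amber) (on blue) ⟩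
  m * (#P amber + #Q amber) + m * (#P blue + #Q blue)
    ≡⟨ *-distribˡ-+ m (#P amber + #Q amber) (#P blue + #Q blue) ⟨
  m * ((#P amber + #Q amber) + (#P blue + #Q blue))
    ≡⟨ cong (m *_) (interchange (#P amber) (#Q amber) (#P blue) (#Q blue)) ⟩
  m * ((#P amber + #P blue) + (#Q amber + #Q blue))  ∎
  where
  open ≡-Reasoning
  restrict : ((Fin (suc k) → Color) → Bool) → Color → (Fin k → Color) → Bool
  restrict R c g = R (c ∷ᵛ g)
  #A #B #P #Q : Color → ℕ
  #A c = countColorings k (restrict A c)
  #B c = countColorings k (restrict B c)
  #P c = countColorings k (restrict P c)
  #Q c = countColorings k (restrict Q c)
  on : ∀ c → #A c + #B c ≡ m * (#P c + #Q c)
  on c = countColorings-pointwise k m (restrict A c) (restrict B c) (restrict P c) (restrict Q c)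
           (λ g → eq (c ∷ᵛ g))

countColorings-flipPairs : ∀ {k} (i : Fin k) m (P Q : (Fin k → Color) → Bool) →
  (∀ {g g'} → FlipPair i g g' → 𝟙 (P g) + 𝟙 (P g') ≡ m * (𝟙 (Q g) + 𝟙 (Q g'))) →
  countColorings k P ≡ m * countColorings k Q
countColorings-flipPairs {suc k} fzero m P Q eq =
  countColorings-pointwise k m _ _ _ _ (λ g → eq (FlipPair-head g))
countColorings-flipPairs {suc k} (fsuc i) m P Q eq = begin
  count P amber + count P blue              ≡⟨ cong₂ _+_ (on amber) (on blue) ⟩
  m * count Q amber + m * count Q blue      ≡⟨ *-distribˡ-+ m (count Q amber) (count Q blue) ⟨
  m * (count Q amber + count Q blue)        ∎
  where
  open ≡-Reasoning
  count : ((Fin (suc k) → Color) → Bool) → Color → ℕ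
  count R c = countColorings k (λ g → R (c ∷ᵛ g))
  on : ∀ c → count P c ≡ m * count Q c
  on c = countColorings-flipPairs i m _ _ (λ fp → eq (FlipPair-tail c fp))

combine-injective : ∀ {n} {r c r' c' : Fin n} → combine r c ≡ combine r' c' → (r , c) ≡ (r' , c')
combine-injective {n} {r} {c} {r'} {c'} eq =
  trans (sym (remQuot-combine r c)) (trans (cong (remQuot n) eq) (remQuot-combine r' c'))

cellIndex : ∀ {n} → Cell n → Fin (n * n)
cellIndex (r , c) = combine r c

FlipPair-toBoard : ∀ {n} {H : Cell n} {g g' : Fin (n * n) → Color} →
                   FlipPair (cellIndex H) g g' → FlipPair H (toBoard g) (toBoard g')
FlipPair-toBoard fp = record
  { amberAt = amberAt fp ; blueAt = blueAt fp
  ; agreeElsewhere = λ p p≢H → agreeElsewhere fp (cellIndex p) (λ eq → p≢H (combine-injective eq)) }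

AmberReach-mono : ∀ {n} {b b' : Board n} → (∀ p → b p ≡ amber → b' p ≡ amber) →
                  ∀ {q} → AmberReach b q → AmberReach b' q
AmberReach-mono b≤b' (start onNW amb)  = start onNW (b≤b' _ amb)
AmberReach-mono b≤b' (step reach adj amb) = step (AmberReach-mono b≤b' reach) adj (b≤b' _ amb)

AliceWins-mono : ∀ {n} {b b' : Board n} → (∀ p → b p ≡ amber → b' p ≡ amber) →
                 AliceWins b → AliceWins b'
AliceWins-mono b≤b' (q , onSE , reach) = q , onSE , AmberReach-mono b≤b' reach

allᵇ-cong : ∀ {A : Set} {P Q : A → Bool} → (∀ x → P x ≡ Q x) → ∀ xs → allᵇ P xs ≡ allᵇ Q xs
allᵇ-cong P≗Q []       = refl
allᵇ-cong P≗Q (x ∷ xs) = cong₂ _∧_ (P≗Q x) (allᵇ-cong P≗Q xs)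

𝟙-∧-scale : ∀ φ m x y z u → 𝟙 x + 𝟙 y ≡ m * (𝟙 z + 𝟙 u) →
            𝟙 (φ ∧ x) + 𝟙 (φ ∧ y) ≡ m * (𝟙 (φ ∧ z) + 𝟙 (φ ∧ u))
𝟙-∧-scale false m x y z u _  = sym (*-zeroʳ m)
𝟙-∧-scale true  m x y z u eq = eq

agreements≡2*losing : ∀ w w' → (w' ≡ amber → w ≡ amber) →
  𝟙 (w ==ᶜ w') + 𝟙 (w' ==ᶜ w) ≡ 2 * (𝟙 (amber ==ᶜ other w) + 𝟙 (blue ==ᶜ other w'))
agreements≡2*losing amber amber _ = refl
agreements≡2*losing amber blue  _ = refl
agreements≡2*losing blue  amber mono with () ← mono refl
agreements≡2*losing blue  blue  _ = refl

module _ {n : ℕ} (dec : (b : Board n) → Dec (AliceWins b)) where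

  winner-cong : ∀ {b b' : Board n} → (∀ p → b p ≡ b' p) → winner dec b ≡ winner dec b'
  winner-cong {b} {b'} b≗b' = cong (if_then amber else blue)
    (does-⇔ (mk⇔ (AliceWins-mono (λ p → trans (sym (b≗b' p)))) (AliceWins-mono (λ p → trans (b≗b' p))))
            (dec b) (dec b'))

  winner-mono : ∀ {b b' : Board n} → (∀ p → b p ≡ amber → b' p ≡ amber) →
                winner dec b ≡ amber → winner dec b' ≡ amber
  winner-mono {b} {b'} b≤b' _ with dec b | dec b'
  ... | _             | yes _         = refl
  ... | yes aliceWins | no ¬aliceWins = contradiction (AliceWins-mono b≤b' aliceWins) ¬aliceWins
  winner-mono {b} {b'} b≤b' () | no _ | no _

  module _ {H : Cell n} {b b' : Board n} (fp : FlipPair H b b') where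

    flipAt-amber : ∀ p → flipAt dec b H p ≡ b' p
    flipAt-amber p with p ≟ᶜᵉˡˡ H
    ... | yes refl rewrite amberAt fp | blueAt fp = refl
    ... | no p≢H   = agreeElsewhere fp p p≢H

    flipAt-blue : ∀ p → flipAt dec b' H p ≡ b p
    flipAt-blue p with p ≟ᶜᵉˡˡ H
    ... | yes refl rewrite amberAt fp | blueAt fp = refl
    ... | no p≢H   = sym (agreeElsewhere fp p p≢H)

    amber-fewer : ∀ p → b' p ≡ amber → b p ≡ amber
    amber-fewer p b'p≡amber with p ≟ᶜᵉˡˡ H
    ... | yes refl = amberAt fp
    ... | no p≢H   = trans (agreeElsewhere fp p p≢H) b'p≡amber

    isFilling-flipPair : ∀ (v : PartialBoard n) → v H ≡ nothing → isFillingᵇ v b ≡ isFillingᵇ v b'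
    isFilling-flipPair v vH = allᵇ-cong agreesAt-same (cartesianProduct (allFin n) (allFin n))
      where
      agreesAt-same : ∀ p → agreesAt v b p ≡ agreesAt v b' p
      agreesAt-same p with p ≟ᶜᵉˡˡ H
      agreesAt-same p | yes refl rewrite vH = refl
      agreesAt-same p | no p≢H with v p
      ... | nothing = refl
      ... | just _  rewrite agreeElsewhere fp p p≢H = refl

    notCritical≡2*losing : ∀ (v : PartialBoard n) → v H ≡ nothing →
      𝟙 (isFillingᵇ v b ∧ isNotCriticalᵇ dec b H) + 𝟙 (isFillingᵇ v b' ∧ isNotCriticalᵇ dec b' H)
        ≡ 2 * (𝟙 (isFillingᵇ v b ∧ hasLosingColorᵇ dec b H) + 𝟙 (isFillingᵇ v b' ∧ hasLosingColorᵇ dec b' H))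
    notCritical≡2*losing v vH
      rewrite sym (isFilling-flipPair v vH) | winner-cong flipAt-amber | winner-cong flipAt-blue
            | amberAt fp | blueAt fp
      = 𝟙-∧-scale (isFillingᵇ v b) 2 _ _ _ _
          (agreements≡2*losing (winner dec b) (winner dec b') (winner-mono amber-fewer))

mainTheorem1 : (n : ℕ) (dec : (b : Board n) → Dec (AliceWins b))
    (v : PartialBoard n) (H : Cell n) → v H ≡ nothing →
    countFillings v (λ b → isNotCriticalᵇ dec b H)
      ≡ 2 * countFillings v (λ b → hasLosingColorᵇ dec b H)
mainTheorem1 n dec v H vH =
  countColorings-flipPairs (cellIndex H) 2 _ _ λ fp →
    notCritical≡2*losing dec (FlipPair-toBoard fp) v vH
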